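{- Let $\lambda=\sum_{i=1}^{m_c}\min_{j}\sum_{i'=1}^{m_p}\frac{P_{i'j}/p_{i'}}{C_{ij}/c_i}$. Then $\lambda^*\le\lambda\le m^2\lambda^*$.
   Context: $P$ is a nonnegative $m_p\times n$ matrix, $C$ a nonnegative $m_c\times n$ matrix, $p\in\mathbb{R}^{m_p}$ and $c\in\mathbb{R}^{m_c}$ positive vectors, $m=m_p+m_c$. $\lambda^*=\min\{\lambda:\exists x\ge0,\ Px\le\lambda p,\ Cx\ge c\}$.
   Formalization: The matrices $P$, $C$ and the vectors $p$, $c$ have rational entries rather than real ones, and the vectors $x$ and values $\lambda$ defining $\lambda^*$ are taken in ℚ. -}

module Defs where

open import Data.Nat using (ℕ; zero; suc)
open import Data.Fin using (Fin; zero; suc)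
open import Data.Maybe using (Maybe; just; nothing)
open import Data.Product using (Σ; _×_)
open import Data.Integer using (+_)
open import Data.Rational using (ℚ; 0ℚ; _+_; _*_; _÷_; _⊓_; _≤_; ≢-nonZero)
open import Data.Rational.Properties using (_≟_)
open import Relation.Nullary using (yes; no)

sumℚ : (n : ℕ) → (Fin n → ℚ) → ℚ
sumℚ zero    f = 0ℚ
sumℚ (suc n) f = f zero + sumℚ n (λ k → f (suc k))

minOpt : (n : ℕ) → (Fin n → Maybe ℚ) → Maybe ℚ
minOpt zero    f = nothing
minOpt (suc n) f with f zero | minOpt n (λ k → f (suc k))
... | nothing | r       = r
... | just a  | nothing = just a
... | just a  | just b  = just (a ⊓ b)

-- Division a / b (only ever used with b ≠ 0; returns 0 for b = 0).
divℚ : ℚ → ℚ → ℚ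
divℚ a b with b ≟ 0ℚ
... | yes _  = 0ℚ
... | no b≢0 = _÷_ a b {{≢-nonZero b≢0}}

-- The j-th term for constraint row i:
--   Σ_{i'} (P_{i'j}/p_{i'}) / (C_{ij}/c_i),  defined only when C_{ij} ≠ 0
-- (when C_{ij} = 0 the term is +∞ and does not contribute to the minimum).
term : {mp mc n : ℕ} → (Fin mp → Fin n → ℚ) → (Fin mc → Fin n → ℚ) →
       (Fin mp → ℚ) → (Fin mc → ℚ) → Fin mc → Fin n → Maybe ℚ
term {mp} P C p c i j with C i j ≟ 0ℚ
... | yes _ = nothing
... | no _  = just (sumℚ mp (λ i' → divℚ (divℚ (P i' j) (p i')) (divℚ (C i j) (c i))))

-- min_j of the above (0 if no j has C_{ij} ≠ 0; excluded by the hypotheses).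
rowMin : {mp mc n : ℕ} → (Fin mp → Fin n → ℚ) → (Fin mc → Fin n → ℚ) →
         (Fin mp → ℚ) → (Fin mc → ℚ) → Fin mc → ℚ
rowMin {n = n} P C p c i with minOpt n (term P C p c i)
... | just v  = v
... | nothing = 0ℚ

lambdaApprox : {mp mc n : ℕ} → (Fin mp → Fin n → ℚ) → (Fin mc → Fin n → ℚ) →
               (Fin mp → ℚ) → (Fin mc → ℚ) → ℚ
lambdaApprox {mc = mc} P C p c = sumℚ mc (rowMin P C p c)

mulVec : {r n : ℕ} → (Fin r → Fin n → ℚ) → (Fin n → ℚ) → Fin r → ℚ
mulVec {n = n} A x i = sumℚ n (λ j → A i j * x j)

Feasible : {mp mc n : ℕ} → (Fin mp → Fin n → ℚ) → (Fin mc → Fin n → ℚ) →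
           (Fin mp → ℚ) → (Fin mc → ℚ) → ℚ → Set
Feasible {n = n} P C p c l =
  Σ (Fin n → ℚ) λ x →
    (∀ j → 0ℚ ≤ x j) ×
    (∀ i → mulVec P x i ≤ l * p i) ×
    (∀ i → c i ≤ mulVec C x i)

IsLambdaStar : {mp mc n : ℕ} → (Fin mp → Fin n → ℚ) → (Fin mc → Fin n → ℚ) →
               (Fin mp → ℚ) → (Fin mc → ℚ) → ℚ → Set
IsLambdaStar P C p c ls =
  Feasible P C p c ls × (∀ l → Feasible P C p c l → ls ≤ l)

{-# OPTIONS --safe #-}

-- Write a_j = Σ_{i′} P_{i′j}/p_{i′} (columnWeight), so that the i-th summand of λ is
-- r_i = min_j a_j c_i / C_{ij} (rowMin), attained at some column J_i (bestColumn).
-- Putting c_i / C_{iJ_i} units on column J_i for every i covers each row of C and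
-- loads row i′ of P by at most Σ_i r_i p_{i′} = λ p_{i′}; hence λ is feasible and
-- λ* ≤ λ.  Conversely, if x is feasible at λ*, the rows of P give
-- Σ_j a_j x_j ≤ m_p λ*, while r_i C_{ij} ≤ a_j c_i together with c_i ≤ (C x)_i gives
-- r_i ≤ Σ_j a_j x_j.  Summing over i and using λ* ≥ 0, λ ≤ m_c m_p λ* ≤ m² λ*.
module Submission where

open import Defs
open import Data.Nat using (ℕ; zero; suc)
open import Data.Fin using (Fin; zero; suc)
open import Data.Product using (Σ; _×_; _,_; proj₁; proj₂)
open import Data.Integer using (+_)
open import Data.Rational using (ℚ; 0ℚ; _*_; _/_; _≤_; _<_)
import Data.Nat as N

open import Algebra.Bundles using (CommutativeMonoid; CommutativeRing)
open import Data.Maybe using (Maybe; just; nothing)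
open import Data.Maybe.Properties using (just-injective)
open import Data.Sum using (inj₁; inj₂)
import Data.Integer as ℤ
import Data.Integer.Properties as ℤ
import Data.Nat.Coprimality as Coprime
import Data.Nat.Properties as N
open import Data.Rational
  using (NonZero; 1ℚ; _+_; _-_; _⊓_; 1/_; *<*; ≢-nonZero; nonNegative; positive)
open import Data.Rational.Properties
open import Relation.Binary.PropositionalEquality
  using (_≡_; _≢_; refl; sym; trans; cong; cong₂; subst; ≢-sym; module ≡-Reasoning)
open import Relation.Nullary using (yes; no; contradiction)

open import Algebra.Properties.CommutativeSemigroup
  (CommutativeMonoid.commutativeSemigroup *-1-commutativeMonoid) using (xy∙z≈xz∙y)
open import Algebra.Properties.Semiring.Sum (CommutativeRing.semiring +-*-commutativeRing)
  using (sum; ∑-comm)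
open import Algebra.Properties.Monoid.Mult +-0-monoid
  using (×-assocˡ) renaming (_×_ to _·_)

pos⇒≢0 : ∀ {a} → 0ℚ < a → a ≢ 0ℚ
pos⇒≢0 0<a = ≢-sym (<⇒≢ 0<a)

*-nonNeg : ∀ {a b} → 0ℚ ≤ a → 0ℚ ≤ b → 0ℚ ≤ a * b
*-nonNeg {a} {b} 0≤a 0≤b =
  nonNegative⁻¹ _ {{nonNeg*nonNeg⇒nonNeg a {{nonNegative 0≤a}} b {{nonNegative 0≤b}}}}

nonNeg∧≢0⇒pos : ∀ {a} → 0ℚ ≤ a → a ≢ 0ℚ → 0ℚ < a
nonNeg∧≢0⇒pos {a} 0≤a a≢0 =
  positive⁻¹ a {{nonNeg∧nonZero⇒pos a {{nonNegative 0≤a}} {{≢-nonZero a≢0}}}}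

nonNeg-cancelʳ-pos : ∀ {a b} → 0ℚ < b → 0ℚ ≤ a * b → 0ℚ ≤ a
nonNeg-cancelʳ-pos {a} {b} 0<b 0≤ab =
  *-cancelʳ-≤-pos b {{positive 0<b}} (subst (_≤ a * b) (sym (*-zeroˡ b)) 0≤ab)

p-1<p : ∀ p → p - 1ℚ < p
p-1<p p = subst (p - 1ℚ <_) (+-identityʳ p) (+-monoʳ-< p (*<* ℤ.-<+))

divℚ-*-cancel : ∀ a {b} → b ≢ 0ℚ → divℚ a b * b ≡ a
divℚ-*-cancel a {b} b≢0 with b ≟ 0ℚ
... | yes b≡0 = contradiction b≡0 b≢0
... | no b≢0′ = begin
  a * (1/ b) * b    ≡⟨ *-assoc a _ b ⟩
  a * ((1/ b) * b)  ≡⟨ cong (a *_) (*-inverseˡ b) ⟩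
  a * 1ℚ            ≡⟨ *-identityʳ a ⟩
  a                 ∎
  where
  open ≡-Reasoning
  instance
    nonZero-b : NonZero b
    nonZero-b = ≢-nonZero b≢0′

divℚ-nonNeg : ∀ {a b} → 0ℚ ≤ a → 0ℚ < b → 0ℚ ≤ divℚ a b
divℚ-nonNeg {a} 0≤a 0<b =
  nonNeg-cancelʳ-pos 0<b (subst (0ℚ ≤_) (sym (divℚ-*-cancel a (pos⇒≢0 0<b))) 0≤a)

divℚ-divℚ-* : ∀ a {b c} → b ≢ 0ℚ → c ≢ 0ℚ → divℚ a (divℚ b c) * b ≡ a * c
divℚ-divℚ-* a {b} {c} b≢0 c≢0 = begin
  divℚ a w * b        ≡⟨ cong (divℚ a w *_) (sym (divℚ-*-cancel b c≢0)) ⟩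
  divℚ a w * (w * c)  ≡⟨ sym (*-assoc (divℚ a w) w c) ⟩
  divℚ a w * w * c    ≡⟨ cong (_* c) (divℚ-*-cancel a w≢0) ⟩
  a * c               ∎
  where
  open ≡-Reasoning
  w : ℚ
  w = divℚ b c
  w≢0 : w ≢ 0ℚ
  w≢0 w≡0 = b≢0 (begin
    b       ≡⟨ sym (divℚ-*-cancel b c≢0) ⟩
    w * c   ≡⟨ cong (_* c) w≡0 ⟩
    0ℚ * c  ≡⟨ *-zeroˡ c ⟩
    0ℚ      ∎)

sumℚ-cong : ∀ n {f g : Fin n → ℚ} → (∀ j → f j ≡ g j) → sumℚ n f ≡ sumℚ n g
sumℚ-cong zero    f≗g = refl
sumℚ-cong (suc n) f≗g = cong₂ _+_ (f≗g zero) (sumℚ-cong n (λ j → f≗g (suc j)))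

sumℚ-mono : ∀ n {f g : Fin n → ℚ} → (∀ j → f j ≤ g j) → sumℚ n f ≤ sumℚ n g
sumℚ-mono zero    f≤g = ≤-refl
sumℚ-mono (suc n) f≤g = +-mono-≤ (f≤g zero) (sumℚ-mono n (λ j → f≤g (suc j)))

sumℚ-nonNeg : ∀ n {f : Fin n → ℚ} → (∀ j → 0ℚ ≤ f j) → 0ℚ ≤ sumℚ n f
sumℚ-nonNeg zero    0≤f = ≤-refl
sumℚ-nonNeg (suc n) 0≤f = +-mono-≤ (0≤f zero) (sumℚ-nonNeg n (λ j → 0≤f (suc j)))

summand≤sumℚ : ∀ n {f : Fin n → ℚ} → (∀ j → 0ℚ ≤ f j) → ∀ j → f j ≤ sumℚ n f
summand≤sumℚ (suc n) {f} 0≤f zero = subst (_≤ sumℚ (suc n) f) (+-identityʳ (f zero))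
  (+-monoʳ-≤ (f zero) (sumℚ-nonNeg n (λ j → 0≤f (suc j))))
summand≤sumℚ (suc n) {f} 0≤f (suc j) = subst (_≤ sumℚ (suc n) f) (+-identityˡ (f (suc j)))
  (+-mono-≤ (0≤f zero) (summand≤sumℚ n (λ k → 0≤f (suc k)) j))

*-distribˡ-sumℚ : ∀ n x (f : Fin n → ℚ) → x * sumℚ n f ≡ sumℚ n (λ j → x * f j)
*-distribˡ-sumℚ zero    x f = *-zeroʳ x
*-distribˡ-sumℚ (suc n) x f =
  trans (*-distribˡ-+ x (f zero) _)
        (cong (λ s → x * f zero + s) (*-distribˡ-sumℚ n x (λ j → f (suc j))))

*-distribʳ-sumℚ : ∀ n x (f : Fin n → ℚ) → sumℚ n f * x ≡ sumℚ n (λ j → f j * x)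
*-distribʳ-sumℚ zero    x f = *-zeroˡ x
*-distribʳ-sumℚ (suc n) x f =
  trans (*-distribʳ-+ x (f zero) _)
        (cong (λ s → f zero * x + s) (*-distribʳ-sumℚ n x (λ j → f (suc j))))

sumℚ≡sum : ∀ n (f : Fin n → ℚ) → sumℚ n f ≡ sum f
sumℚ≡sum zero    f = refl
sumℚ≡sum (suc n) f = cong (λ s → f zero + s) (sumℚ≡sum n (λ j → f (suc j)))

sumℚ-comm : ∀ m n (f : Fin m → Fin n → ℚ) →
            sumℚ m (λ i → sumℚ n (f i)) ≡ sumℚ n (λ j → sumℚ m (λ i → f i j))
sumℚ-comm m n f = begin
  sumℚ m (λ i → sumℚ n (f i))           ≡⟨ sumℚ-cong m (λ i → sumℚ≡sum n (f i)) ⟩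
  sumℚ m (λ i → sum (f i))              ≡⟨ sumℚ≡sum m _ ⟩
  sum (λ i → sum (f i))                 ≡⟨ ∑-comm f ⟩
  sum (λ j → sum (λ i → f i j))         ≡⟨ sumℚ≡sum n _ ⟨
  sumℚ n (λ j → sum (λ i → f i j))      ≡⟨ sumℚ-cong n (λ j → sumℚ≡sum m (λ i → f i j)) ⟨
  sumℚ n (λ j → sumℚ m (λ i → f i j))   ∎
  where open ≡-Reasoning

sumℚ-const : ∀ k x → sumℚ k (λ _ → x) ≡ k · x
sumℚ-const zero    x = refl
sumℚ-const (suc k) x = cong (λ s → x + s) (sumℚ-const k x)

·-nonNeg : ∀ k {x} → 0ℚ ≤ x → 0ℚ ≤ k · x
·-nonNeg k {x} 0≤x = subst (0ℚ ≤_) (sumℚ-const k x) (sumℚ-nonNeg k (λ _ → 0≤x))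

·-monoˡ-≤ : ∀ {k l x} → 0ℚ ≤ x → k N.≤ l → k · x ≤ l · x
·-monoˡ-≤ 0≤x (N.z≤n {l}) = ·-nonNeg l 0≤x
·-monoˡ-≤ {x = x} 0≤x (N.s≤s k≤l) = +-monoʳ-≤ x (·-monoˡ-≤ 0≤x k≤l)

-- Once `+ k / 1` is in normal form, `1ℚ + + k / 1` computes to `+ suc k / 1`.
+[1+k]/1 : ∀ k → + suc k / 1 ≡ 1ℚ + + k / 1
+[1+k]/1 k rewrite normalize-coprime {k} {0} (Coprime.sym (Coprime.1-coprimeTo k))
                 | ℤ.*-identityʳ (+ k) = refl

·≡/1* : ∀ k x → k · x ≡ (+ k / 1) * x
·≡/1* zero    x = sym (*-zeroˡ x)
·≡/1* (suc k) x = begin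
  x + k · x                ≡⟨ cong₂ _+_ (sym (*-identityˡ x)) (·≡/1* k x) ⟩
  1ℚ * x + (+ k / 1) * x   ≡⟨ *-distribʳ-+ x 1ℚ (+ k / 1) ⟨
  (1ℚ + + k / 1) * x       ≡⟨ cong (_* x) (+[1+k]/1 k) ⟨
  (+ suc k / 1) * x      ∎
  where open ≡-Reasoning

divℚ-dot≤ : ∀ {n} {f y : Fin n → ℚ} {b l} → 0ℚ < b →
            sumℚ n (λ j → f j * y j) ≤ l * b → sumℚ n (λ j → divℚ (f j) b * y j) ≤ l
divℚ-dot≤ {n} {f} {y} {b} {l} 0<b fy≤lb = *-cancelʳ-≤-pos b {{positive 0<b}} (begin
  sumℚ n (λ j → divℚ (f j) b * y j) * b
    ≡⟨ *-distribʳ-sumℚ n b _ ⟩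
  sumℚ n (λ j → divℚ (f j) b * y j * b)
    ≡⟨ sumℚ-cong n (λ j → xy∙z≈xz∙y (divℚ (f j) b) (y j) b) ⟩
  sumℚ n (λ j → divℚ (f j) b * b * y j)
    ≡⟨ sumℚ-cong n (λ j → cong (_* y j) (divℚ-*-cancel (f j) b≢0)) ⟩
  sumℚ n (λ j → f j * y j)
    ≤⟨ fy≤lb ⟩
  l * b
    ∎)
  where
  open ≤-Reasoning
  b≢0 : b ≢ 0ℚ
  b≢0 = pos⇒≢0 0<b

≤-dot-of-cover : ∀ n {r d} {u a y : Fin n → ℚ} → 0ℚ ≤ r → 0ℚ < d → (∀ j → 0ℚ ≤ y j) →
                 d ≤ sumℚ n (λ j → u j * y j) → (∀ j → r * u j ≤ a j * d) →
                 r ≤ sumℚ n (λ j → a j * y j)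
≤-dot-of-cover n {r} {d} {u} {a} {y} 0≤r 0<d 0≤y d≤u·y ru≤ad =
  *-cancelʳ-≤-pos d {{positive 0<d}} (begin
    r * d
      ≤⟨ *-monoˡ-≤-nonNeg r {{nonNegative 0≤r}} d≤u·y ⟩
    r * sumℚ n (λ j → u j * y j)
      ≡⟨ *-distribˡ-sumℚ n r _ ⟩
    sumℚ n (λ j → r * (u j * y j))
      ≡⟨ sumℚ-cong n (λ j → *-assoc r (u j) (y j)) ⟨
    sumℚ n (λ j → r * u j * y j)
      ≤⟨ sumℚ-mono n (λ j → *-monoʳ-≤-nonNeg (y j) {{nonNegative (0≤y j)}} (ru≤ad j)) ⟩
    sumℚ n (λ j → a j * d * y j)
      ≡⟨ sumℚ-cong n (λ j → xy∙z≈xz∙y (a j) d (y j)) ⟩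
    sumℚ n (λ j → a j * y j * d)
      ≡⟨ *-distribʳ-sumℚ n d _ ⟨
    sumℚ n (λ j → a j * y j) * d
      ∎)
  where open ≤-Reasoning

basis : ∀ {n} → Fin n → Fin n → ℚ
basis zero    zero    = 1ℚ
basis zero    (suc _) = 0ℚ
basis (suc _) zero    = 0ℚ
basis (suc i) (suc j) = basis i j

sumℚ-*-basis : ∀ n (f : Fin n → ℚ) i → sumℚ n (λ j → f j * basis i j) ≡ f i
sumℚ-*-basis (suc n) f zero = begin
  f zero * 1ℚ + sumℚ n (λ j → f (suc j) * 0ℚ)
    ≡⟨ cong₂ _+_ (*-identityʳ (f zero)) (sym (*-distribʳ-sumℚ n 0ℚ (λ j → f (suc j)))) ⟩
  f zero + sumℚ n (λ j → f (suc j)) * 0ℚ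
    ≡⟨ cong (λ s → f zero + s) (*-zeroʳ (sumℚ n (λ j → f (suc j)))) ⟩
  f zero + 0ℚ
    ≡⟨ +-identityʳ (f zero) ⟩
  f zero
    ∎
  where open ≡-Reasoning
sumℚ-*-basis (suc n) f (suc i) =
  trans (cong (_+ rest) (*-zeroʳ (f zero)))
        (trans (+-identityˡ rest) (sumℚ-*-basis n (λ j → f (suc j)) i))
  where
  rest : ℚ
  rest = sumℚ n (λ j → f (suc j) * basis i j)

combination : ∀ {m n} → (Fin m → Fin n) → (Fin m → ℚ) → Fin n → ℚ
combination {m} J s j = sumℚ m (λ i → basis (J i) j * s i)

combination-nonNeg : ∀ {m n} (J : Fin m → Fin n) {s : Fin m → ℚ} →
                     (∀ i → 0ℚ ≤ s i) → ∀ j → 0ℚ ≤ combination J s j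
combination-nonNeg {m} J 0≤s j = sumℚ-nonNeg m (λ i → *-nonNeg (basis-nonNeg (J i) j) (0≤s i))
  where
  basis-nonNeg : ∀ {n} (i j : Fin n) → 0ℚ ≤ basis i j
  basis-nonNeg zero    zero    = nonNegative⁻¹ 1ℚ
  basis-nonNeg zero    (suc _) = ≤-refl
  basis-nonNeg (suc _) zero    = ≤-refl
  basis-nonNeg (suc i) (suc j) = basis-nonNeg i j

mulVec-combination : ∀ {r m n} (A : Fin r → Fin n → ℚ) (J : Fin m → Fin n) (s : Fin m → ℚ) k →
                     mulVec A (combination J s) k ≡ sumℚ m (λ i → A k (J i) * s i)
mulVec-combination {m = m} {n} A J s k = begin
  sumℚ n (λ j → A k j * sumℚ m (λ i → basis (J i) j * s i))
    ≡⟨ sumℚ-cong n (λ j → *-distribˡ-sumℚ m (A k j) _) ⟩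
  sumℚ n (λ j → sumℚ m (λ i → A k j * (basis (J i) j * s i)))
    ≡⟨ sumℚ-comm n m _ ⟩
  sumℚ m (λ i → sumℚ n (λ j → A k j * (basis (J i) j * s i)))
    ≡⟨ sumℚ-cong m (λ i → sumℚ-cong n (λ j → *-assoc (A k j) _ (s i))) ⟨
  sumℚ m (λ i → sumℚ n (λ j → A k j * basis (J i) j * s i))
    ≡⟨ sumℚ-cong m (λ i → *-distribʳ-sumℚ n (s i) _) ⟨
  sumℚ m (λ i → sumℚ n (λ j → A k j * basis (J i) j) * s i)
    ≡⟨ sumℚ-cong m (λ i → cong (_* s i) (sumℚ-*-basis n (A k) (J i))) ⟩
  sumℚ m (λ i → A k (J i) * s i)
    ∎
  where open ≡-Reasoning

record IsMinimum {n} (f : Fin n → Maybe ℚ) (v : ℚ) : Set where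
  field
    argmin   : Fin n
    attained : f argmin ≡ just v
    minimal  : ∀ j {w} → f j ≡ just w → v ≤ w

minOpt-nothing : ∀ n (f : Fin n → Maybe ℚ) → minOpt n f ≡ nothing → ∀ j → f j ≡ nothing
minOpt-nothing (suc n) f eq j with f zero in f0 | minOpt n (λ k → f (suc k)) in rest
minOpt-nothing (suc n) f eq zero    | nothing | _ = f0
minOpt-nothing (suc n) f eq (suc j) | nothing | _ = minOpt-nothing n _ (trans rest eq) j
minOpt-nothing (suc n) f () j | just _ | nothing
minOpt-nothing (suc n) f () j | just _ | just _

minOpt-isMinimum : ∀ n (f : Fin n → Maybe ℚ) {v} → minOpt n f ≡ just v → IsMinimum f v
minOpt-isMinimum (suc n) f eq with f zero in f0 | minOpt n (λ k → f (suc k)) in rest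
... | nothing | _ = record
  { argmin   = suc argmin
  ; attained = attained
  ; minimal  = λ { zero f0≡just → contradiction (trans (sym f0) f0≡just) λ ()
                 ; (suc j) → minimal j } }
  where open IsMinimum (minOpt-isMinimum n _ (trans rest eq))
minOpt-isMinimum (suc n) f refl | just a | nothing = record
  { argmin   = zero
  ; attained = f0
  ; minimal  = λ { zero f0≡just → ≤-reflexive (just-injective (trans (sym f0) f0≡just))
                 ; (suc j) fj≡just →
                     contradiction (trans (sym fj≡just) (minOpt-nothing n _ rest j)) λ () } }
minOpt-isMinimum (suc n) f refl | just a | just b = record
  { argmin   = argmin′
  ; attained = attained′
  ; minimal  = λ { zero f0≡just →
                     ≤-trans (p⊓q≤p a b) (≤-reflexive (just-injective (trans (sym f0) f0≡just)))
                 ; (suc j) fj≡just → ≤-trans (p⊓q≤q a b) (minimal j fj≡just) } }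
  where
  open IsMinimum (minOpt-isMinimum n _ rest)
  argmin′ : Fin (suc n)
  attained′ : f argmin′ ≡ just (a ⊓ b)
  argmin′ with ⊓-sel a b
  ... | inj₁ _ = zero
  ... | inj₂ _ = suc argmin
  attained′ with ⊓-sel a b
  ... | inj₁ a⊓b≡a = trans f0 (cong just (sym a⊓b≡a))
  ... | inj₂ a⊓b≡b = trans attained (cong just (sym a⊓b≡b))

module _ {mp mc n : ℕ} {P : Fin mp → Fin n → ℚ} {C : Fin mc → Fin n → ℚ}
         {p : Fin mp → ℚ} {c : Fin mc → ℚ}
         (0≤P : ∀ i j → 0ℚ ≤ P i j) (0≤C : ∀ i j → 0ℚ ≤ C i j)
         (0<p : ∀ i → 0ℚ < p i) (0<c : ∀ i → 0ℚ < c i) where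

  columnWeight : Fin n → ℚ
  columnWeight j = sumℚ mp (λ i → divℚ (P i j) (p i))

  ratio : Fin mc → Fin n → ℚ
  ratio i j = sumℚ mp (λ i′ → divℚ (divℚ (P i′ j) (p i′)) (divℚ (C i j) (c i)))

  columnWeight-nonNeg : ∀ j → 0ℚ ≤ columnWeight j
  columnWeight-nonNeg j = sumℚ-nonNeg mp (λ i → divℚ-nonNeg (0≤P i j) (0<p i))

  P≤columnWeight*p : ∀ i j → P i j ≤ columnWeight j * p i
  P≤columnWeight*p i j = begin
    P i j                       ≡⟨ divℚ-*-cancel (P i j) (pos⇒≢0 (0<p i)) ⟨
    divℚ (P i j) (p i) * p i    ≤⟨ *-monoʳ-≤-nonNeg (p i) {{nonNegative (<⇒≤ (0<p i))}}
                                     (summand≤sumℚ mp (λ i′ → divℚ-nonNeg (0≤P i′ j) (0<p i′)) i) ⟩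
    columnWeight j * p i        ∎
    where open ≤-Reasoning

  ratio-*-C : ∀ i j → 0ℚ < C i j → ratio i j * C i j ≡ columnWeight j * c i
  ratio-*-C i j 0<C = begin
    ratio i j * C i j
      ≡⟨ *-distribʳ-sumℚ mp (C i j) _ ⟩
    sumℚ mp (λ i′ → divℚ (divℚ (P i′ j) (p i′)) (divℚ (C i j) (c i)) * C i j)
      ≡⟨ sumℚ-cong mp (λ i′ → divℚ-divℚ-* _ (pos⇒≢0 0<C) (pos⇒≢0 (0<c i))) ⟩
    sumℚ mp (λ i′ → divℚ (P i′ j) (p i′) * c i)
      ≡⟨ *-distribʳ-sumℚ mp (c i) _ ⟨
    columnWeight j * c i
      ∎
    where open ≡-Reasoning

  ratio-nonNeg : ∀ i j → 0ℚ < C i j → 0ℚ ≤ ratio i j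
  ratio-nonNeg i j 0<C = nonNeg-cancelʳ-pos 0<C
    (subst (0ℚ ≤_) (sym (ratio-*-C i j 0<C)) (*-nonNeg (columnWeight-nonNeg j) (<⇒≤ (0<c i))))

  term-pos : ∀ i j → 0ℚ < C i j → term P C p c i j ≡ just (ratio i j)
  term-pos i j 0<C with C i j ≟ 0ℚ
  ... | yes C≡0 = contradiction C≡0 (pos⇒≢0 0<C)
  ... | no _    = refl

  term-just : ∀ i j {w} → term P C p c i j ≡ just w → 0ℚ < C i j × w ≡ ratio i j
  term-just i j eq with C i j ≟ 0ℚ
  term-just i j ()   | yes _
  term-just i j refl | no C≢0 = nonNeg∧≢0⇒pos (0≤C i j) C≢0 , refl

  columnWeight-dot≤ : ∀ {y l} → (∀ i → mulVec P y i ≤ l * p i) →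
                      sumℚ n (λ j → columnWeight j * y j) ≤ mp · l
  columnWeight-dot≤ {y} {l} Py≤lp = begin
    sumℚ n (λ j → columnWeight j * y j)
      ≡⟨ sumℚ-cong n (λ j → *-distribʳ-sumℚ mp (y j) _) ⟩
    sumℚ n (λ j → sumℚ mp (λ i → divℚ (P i j) (p i) * y j))
      ≡⟨ sumℚ-comm n mp _ ⟩
    sumℚ mp (λ i → sumℚ n (λ j → divℚ (P i j) (p i) * y j))
      ≤⟨ sumℚ-mono mp (λ i → divℚ-dot≤ {f = P i} (0<p i) (Py≤lp i)) ⟩
    sumℚ mp (λ _ → l)
      ≡⟨ sumℚ-const mp l ⟩
    mp · l
      ∎
    where open ≤-Reasoning

  rowMin-isMinimum : (∀ i → Σ (Fin n) λ j → 0ℚ < C i j) →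
                     ∀ i → IsMinimum (term P C p c i) (rowMin P C p c i)
  rowMin-isMinimum support i with minOpt n (term P C p c i) in eq
  ... | just v  = minOpt-isMinimum n _ eq
  ... | nothing with support i
  ...   | j , 0<C = contradiction (trans (sym (term-pos i j 0<C)) (minOpt-nothing n _ eq j)) λ ()

  module _ (support : ∀ i → Σ (Fin n) λ j → 0ℚ < C i j) where
    private
      module Min i = IsMinimum (rowMin-isMinimum support i)

    bestColumn : Fin mc → Fin n
    bestColumn i = Min.argmin i

    0<C-bestColumn : ∀ i → 0ℚ < C i (bestColumn i)
    0<C-bestColumn i = proj₁ (term-just i _ (Min.attained i))

    rowMin≡ratio : ∀ i → rowMin P C p c i ≡ ratio i (bestColumn i)
    rowMin≡ratio i = proj₂ (term-just i _ (Min.attained i))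

    rowMin-nonNeg : ∀ i → 0ℚ ≤ rowMin P C p c i
    rowMin-nonNeg i =
      subst (0ℚ ≤_) (sym (rowMin≡ratio i)) (ratio-nonNeg i _ (0<C-bestColumn i))

    rowMin*C≤columnWeight*c : ∀ i j → rowMin P C p c i * C i j ≤ columnWeight j * c i
    rowMin*C≤columnWeight*c i j with C i j ≟ 0ℚ
    ... | yes C≡0 = begin
      rowMin P C p c i * C i j   ≡⟨ cong (rowMin P C p c i *_) C≡0 ⟩
      rowMin P C p c i * 0ℚ      ≡⟨ *-zeroʳ (rowMin P C p c i) ⟩
      0ℚ                         ≤⟨ *-nonNeg (columnWeight-nonNeg j) (<⇒≤ (0<c i)) ⟩
      columnWeight j * c i       ∎
      where open ≤-Reasoning
    ... | no C≢0 = begin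
      rowMin P C p c i * C i j   ≤⟨ *-monoʳ-≤-nonNeg (C i j) {{nonNegative (0≤C i j)}}
                                      (Min.minimal i j (term-pos i j 0<C)) ⟩
      ratio i j * C i j          ≡⟨ ratio-*-C i j 0<C ⟩
      columnWeight j * c i       ∎
      where
      open ≤-Reasoning
      0<C : 0ℚ < C i j
      0<C = nonNeg∧≢0⇒pos (0≤C i j) C≢0

    amount : Fin mc → ℚ
    amount i = divℚ (c i) (C i (bestColumn i))

    amount-nonNeg : ∀ i → 0ℚ ≤ amount i
    amount-nonNeg i = divℚ-nonNeg (<⇒≤ (0<c i)) (0<C-bestColumn i)

    C*amount≡c : ∀ i → C i (bestColumn i) * amount i ≡ c i
    C*amount≡c i =
      trans (*-comm _ (amount i)) (divℚ-*-cancel (c i) (pos⇒≢0 (0<C-bestColumn i)))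

    P*amount≤rowMin*p : ∀ i′ i → P i′ (bestColumn i) * amount i ≤ rowMin P C p c i * p i′
    P*amount≤rowMin*p i′ i = *-cancelʳ-≤-pos Cᵢ {{positive (0<C-bestColumn i)}} (begin
      P i′ J * amount i * Cᵢ
        ≡⟨ *-assoc (P i′ J) (amount i) Cᵢ ⟩
      P i′ J * (amount i * Cᵢ)
        ≡⟨ cong (P i′ J *_) (trans (*-comm (amount i) Cᵢ) (C*amount≡c i)) ⟩
      P i′ J * c i
        ≤⟨ *-monoʳ-≤-nonNeg (c i) {{nonNegative (<⇒≤ (0<c i))}} (P≤columnWeight*p i′ J) ⟩
      columnWeight J * p i′ * c i
        ≡⟨ xy∙z≈xz∙y (columnWeight J) (p i′) (c i) ⟩
      columnWeight J * c i * p i′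
        ≡⟨ cong (_* p i′) (ratio-*-C i J (0<C-bestColumn i)) ⟨
      ratio i J * Cᵢ * p i′
        ≡⟨ xy∙z≈xz∙y (ratio i J) Cᵢ (p i′) ⟩
      ratio i J * p i′ * Cᵢ
        ≡⟨ cong (λ t → t * p i′ * Cᵢ) (rowMin≡ratio i) ⟨
      rowMin P C p c i * p i′ * Cᵢ
        ∎)
      where
      open ≤-Reasoning
      J : Fin n
      J = bestColumn i
      Cᵢ : ℚ
      Cᵢ = C i J

    lambdaApprox-feasible : Feasible P C p c (lambdaApprox P C p c)
    lambdaApprox-feasible = x , combination-nonNeg bestColumn amount-nonNeg , packing , covering
      where
      open ≤-Reasoning
      x : Fin n → ℚ
      x = combination bestColumn amount

      packing : ∀ i′ → mulVec P x i′ ≤ lambdaApprox P C p c * p i′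
      packing i′ = begin
        mulVec P x i′                                   ≡⟨ mulVec-combination P bestColumn amount i′ ⟩
        sumℚ mc (λ i → P i′ (bestColumn i) * amount i)  ≤⟨ sumℚ-mono mc (P*amount≤rowMin*p i′) ⟩
        sumℚ mc (λ i → rowMin P C p c i * p i′)         ≡⟨ *-distribʳ-sumℚ mc (p i′) _ ⟨
        lambdaApprox P C p c * p i′                     ∎

      covering : ∀ k → c k ≤ mulVec C x k
      covering k = begin
        c k                                             ≡⟨ C*amount≡c k ⟨
        C k (bestColumn k) * amount k                   ≤⟨ summand≤sumℚ mc C-terms-nonNeg k ⟩
        sumℚ mc (λ i → C k (bestColumn i) * amount i)   ≡⟨ mulVec-combination C bestColumn amount k ⟨
        mulVec C x k                                    ∎
        where
        C-terms-nonNeg : ∀ i → 0ℚ ≤ C k (bestColumn i) * amount i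
        C-terms-nonNeg i = *-nonNeg (0≤C k (bestColumn i)) (amount-nonNeg i)

    lambdaApprox≤ : ∀ {l} → Feasible P C p c l → lambdaApprox P C p c ≤ mc · (mp · l)
    lambdaApprox≤ {l} (y , 0≤y , Py≤lp , c≤Cy) =
      subst (lambdaApprox P C p c ≤_) (sumℚ-const mc (mp · l)) (sumℚ-mono mc rowMin≤)
      where
      rowMin≤ : ∀ i → rowMin P C p c i ≤ mp · l
      rowMin≤ i = ≤-trans
        (≤-dot-of-cover n {u = C i} {a = columnWeight}
                        (rowMin-nonNeg i) (0<c i) 0≤y (c≤Cy i) (rowMin*C≤columnWeight*c i))
        (columnWeight-dot≤ Py≤lp)

lambdaStar-nonNeg : ∀ {mp mc n} {P : Fin mp → Fin n → ℚ} {C : Fin mc → Fin n → ℚ}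
                      {p : Fin mp → ℚ} {c : Fin mc → ℚ} {l : ℚ} →
                    (∀ i j → 0ℚ ≤ P i j) → (∀ i → 0ℚ < p i) → IsLambdaStar P C p c l → 0ℚ ≤ l
-- With no rows in P every λ′ is feasible, so there is no least one.
lambdaStar-nonNeg {zero} {l = l} _ _ ((y , 0≤y , _ , c≤Cy) , minimal) =
  contradiction (≤-<-trans (minimal (l - 1ℚ) (y , 0≤y , (λ ()) , c≤Cy)) (p-1<p l)) (<-irrefl refl)
lambdaStar-nonNeg {suc _} {n = n} 0≤P 0<p ((y , 0≤y , Py≤lp , _) , _) =
  nonNeg-cancelʳ-pos (0<p zero)
    (≤-trans (sumℚ-nonNeg n (λ j → *-nonNeg (0≤P zero j) (0≤y j))) (Py≤lp zero))

lemma9 : (mp mc n : ℕ) (P : Fin mp → Fin n → ℚ) (C : Fin mc → Fin n → ℚ)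
         (p : Fin mp → ℚ) (c : Fin mc → ℚ) →
         (∀ i j → 0ℚ ≤ P i j) → (∀ i j → 0ℚ ≤ C i j) →
         (∀ i → 0ℚ < p i) → (∀ i → 0ℚ < c i) →
         (∀ i → Σ (Fin n) λ j → 0ℚ < C i j) →
         (ls : ℚ) → IsLambdaStar P C p c ls →
         (ls ≤ lambdaApprox P C p c) ×
         (lambdaApprox P C p c ≤ ((+ ((mp N.+ mc) N.* (mp N.+ mc))) / 1) * ls)
lemma9 mp mc n P C p c 0≤P 0≤C 0<p 0<c support ls ls-least@(ls-feasible , minimal) =
  minimal _ (lambdaApprox-feasible 0≤P 0≤C 0<p 0<c support) ,
  (begin
    lambdaApprox P C p c     ≤⟨ lambdaApprox≤ 0≤P 0≤C 0<p 0<c support ls-feasible ⟩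
    mc · (mp · ls)           ≡⟨ ×-assocˡ ls mc mp ⟩
    (mc N.* mp) · ls         ≤⟨ ·-monoˡ-≤ (lambdaStar-nonNeg {C = C} {c = c} 0≤P 0<p ls-least)
                                  (N.*-mono-≤ (N.m≤n+m mc mp) (N.m≤m+n mp mc)) ⟩
    (m N.* m) · ls           ≡⟨ ·≡/1* (m N.* m) ls ⟩
    (+ (m N.* m) / 1) * ls   ∎)
  where
  open ≤-Reasoning
  m : ℕ
  m = mp N.+ mc
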